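{- Let $m,n$ be positive integers and let $Q(m,n)$ be the graph obtained from the complete graph $K_m$ and $m$ pairwise disjoint copies of the complete graph $K_n$ by identifying each vertex of $K_m$ with a vertex of its own (unique) copy of $K_n$. Then (i) $Mo(Q(m,n))=mn(m-1)(n-1)$; (ii) $Mo_e(Q(m,n))=\frac{m(n-1)(m-1)}{2}\,(n^2-n+m)$.
   Context: For a graph $G$ and an edge $e=uv$, $n_u(e,G)$ denotes the number of vertices of $G$ strictly closer to $u$ than to $v$ (and $n_v(e,G)$ analogously). The Mostar index is $Mo(G)=\sum_{uv\in E(G)}|n_u(uv,G)-n_v(uv,G)|$. For a vertex $w$ and an edge $f=ab$ put $d(w,f)=\min\{d(w,a),d(w,b)\}$; $m_u(e|G)$ is the number of edges $f$ of $G$ with $d(u,f)<d(v,f)$, and $m_v(e|G)$ analogously. The edge Mostar index is $Mo_e(G)=\sum_{e=uv\in E(G)}|m_u(e|G)-m_v(e|G)|$. -}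

module Defs where

open import Data.Nat using (ℕ; zero; suc; _+_; _*_; _⊓_; _<ᵇ_; _≡ᵇ_; ∣_-_∣)
open import Data.Fin using (Fin; toℕ; remQuot)
open import Data.Bool using (Bool; true; false; _∧_; _∨_; not; if_then_else_)
open import Data.List using (map; allFin)
open import Data.Nat.ListAction using (sum)
open import Data.Bool.ListAction using (any)
open import Data.Product using (_,_)

Graph : ℕ → Set
Graph N = Fin N → Fin N → Bool

ΣV : ∀ {N} → (Fin N → ℕ) → ℕ
ΣV {N} f = sum (map f (allFin N))

eqV : ∀ {N} → Fin N → Fin N → Bool
eqV u v = toℕ u ≡ᵇ toℕ v

reach : ∀ {N} → Graph N → ℕ → Fin N → Fin N → Bool
reach G zero    u v = eqV u v
reach {N} G (suc k) u v = reach G k u v ∨ any (λ w → G u w ∧ reach G k w v) (allFin N)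

distSearch : ∀ {N} → Graph N → Fin N → Fin N → ℕ → ℕ → ℕ
distSearch G u v zero     k = k
distSearch G u v (suc f)  k = if reach G k u v then k else distSearch G u v f (suc k)

-- shortest-path distance d(u,v) (for connected graphs; a path has length < N)
dist : ∀ {N} → Graph N → Fin N → Fin N → ℕ
dist {N} G u v = distSearch G u v N 0

[_] : Bool → ℕ
[ true ]  = 1
[ false ] = 0

ΣE : ∀ {N} → Graph N → (Fin N → Fin N → ℕ) → ℕ
ΣE G f = ΣV (λ a → ΣV (λ b → if (toℕ a <ᵇ toℕ b) ∧ G a b then f a b else 0))

nV : ∀ {N} → Graph N → Fin N → Fin N → ℕ
nV G u v = ΣV (λ w → [ dist G w u <ᵇ dist G w v ])

Mo : ∀ {N} → Graph N → ℕ
Mo G = ΣE G (λ u v → ∣ nV G u v - nV G v u ∣)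

distE : ∀ {N} → Graph N → Fin N → Fin N → Fin N → ℕ
distE G w a b = dist G w a ⊓ dist G w b

mE : ∀ {N} → Graph N → Fin N → Fin N → ℕ
mE G u v = ΣE G (λ a b → [ distE G u a b <ᵇ distE G v a b ])

Moe : ∀ {N} → Graph N → ℕ
Moe G = ΣE G (λ u v → ∣ mE G u v - mE G v u ∣)

-- Q(m,n): vertex (i,a) ∈ Fin m × Fin n is vertex a of the i-th copy of K_n;
-- vertex (i,0) is identified with vertex i of K_m.
Q : (m n : ℕ) → Graph (m * n)
Q m n x y with remQuot {m} n x | remQuot {m} n y
... | i , a | j , b =
  (eqV i j ∧ not (eqV a b)) ∨ (not (eqV i j) ∧ (toℕ a ≡ᵇ 0) ∧ (toℕ b ≡ᵇ 0))

-- Write h(a) ∈ {0,1} for the distance from a vertex a of a copy of K_n to the root of that copy.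
-- Distances in Q(m,n) are explicit: 0 or 1 within a copy, and h(a) + 1 + h(b) between (i,a) and
-- (j,b) for i ≠ j; that this function is the graph distance follows from the fact that it vanishes
-- exactly on the diagonal, is 1-Lipschitz along edges and decreases along some edge when positive.
-- Hence an edge inside a copy contributes to Mo or Mo_e only if exactly one endpoint is the root,
-- and then a constant, namely (m-1)n for Mo and (m-1)(n^2-n+m)/2 for Mo_e, while the edges of K_m
-- contribute nothing by symmetry. There are m(n-1) edges of the first kind.

module Submission where

open import Defs
open import Data.Nat using (ℕ; zero; suc; _+_; _*_; _∸_; _≥_; _≤_; _<_; z≤n; s≤s; _⊓_; _<ᵇ_; _≡ᵇ_; ∣_-_∣)
open import Data.Nat.Properties
open import Data.Nat.DivMod using (_/_; m*n/n≡m)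
open import Data.Nat.ListAction using () renaming (sum to sumList)
open import Data.Nat.Tactic.RingSolver using (solve-∀)
open import Data.Fin using (Fin; zero; suc; toℕ; remQuot; combine; _↑ˡ_; _↑ʳ_)
open import Data.Fin.Properties using (toℕ-injective; remQuot-combine; combine-remQuot)
open import Data.Bool using (Bool; true; false; _∧_; _∨_; _xor_; not; if_then_else_)
open import Data.Bool.Properties using (T-≡; ∧-comm)
open import Data.Bool.ListAction using (any)
open import Data.List using (allFin; tabulate)
open import Data.List.Properties using (map-tabulate)
open import Data.List.Membership.Propositional using (lose)
open import Data.List.Membership.Propositional.Properties using (∈-allFin)
open import Data.List.Relation.Unary.Any using (satisfied)
open import Data.List.Relation.Unary.Any.Properties using (any⁺; any⁻)
open import Data.Product using (_×_; _,_; proj₁; proj₂; Σ-syntax)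
open import Data.Empty using (⊥-elim)
open import Function using (id; _∘_; Equivalence)
open import Relation.Binary.PropositionalEquality hiding ([_])
open import Relation.Nullary using (yes; no; ¬_; contradiction)
open import Relation.Binary.Definitions using (tri<; tri≈; tri>)
open import Algebra.Properties.Semiring.Sum +-*-semiring
  using (sum; sum-syntax; sum-cong-≗; ∑-distrib-+; ∑-comm; *-distribˡ-sum)
open import Algebra.Properties.CommutativeSemigroup +-commutativeSemigroup using (x∙yz≈y∙xz)

open Equivalence using (to; from)

ΣV≡∑ : ∀ {N} (f : Fin N → ℕ) → ΣV f ≡ ∑[ x < N ] f x
ΣV≡∑ {N} f = trans (cong sumList (map-tabulate id f)) (sumList-tabulate f)
  where
  sumList-tabulate : ∀ {n} (g : Fin n → ℕ) → sumList (tabulate g) ≡ sum g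
  sumList-tabulate {zero}  g = refl
  sumList-tabulate {suc n} g = cong (g zero +_) (sumList-tabulate (g ∘ suc))

∑-const : ∀ n c → ∑[ i < n ] c ≡ n * c
∑-const zero    c = refl
∑-const (suc n) c = cong (c +_) (∑-const n c)

∑-zero : ∀ {n} (f : Fin n → ℕ) → (∀ i → f i ≡ 0) → sum f ≡ 0
∑-zero {n} f f≡0 = trans (sum-cong-≗ f≡0) (trans (∑-const n 0) (*-zeroʳ n))

∑-↑ : ∀ n k (f : Fin (n + k) → ℕ) → sum f ≡ ∑[ i < n ] f (i ↑ˡ k) + ∑[ j < k ] f (n ↑ʳ j)
∑-↑ zero    k f = refl
∑-↑ (suc n) k f = trans (cong (f zero +_) (∑-↑ n k (f ∘ suc))) (sym (+-assoc (f zero) _ _))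

∑-combine : ∀ m n (f : Fin (m * n) → ℕ) → sum f ≡ ∑[ i < m ] ∑[ a < n ] f (combine i a)
∑-combine zero    n f = refl
∑-combine (suc m) n f =
  trans (∑-↑ n (m * n) f) (cong (∑[ a < n ] f (a ↑ˡ (m * n)) +_) (∑-combine m n (f ∘ (n ↑ʳ_))))

∑-onePoint : ∀ {n} (a : Fin n) (f : Fin n → ℕ) x y →
             (∀ b → f b ≡ (if eqV b a then x else y)) → sum f ≡ x + (n ∸ 1) * y
∑-onePoint {suc n} zero f x y hf =
  cong₂ _+_ (hf zero) (trans (sum-cong-≗ (hf ∘ suc)) (∑-const n y))
∑-onePoint {suc (suc n)} (suc a) f x y hf =
  trans (cong₂ _+_ (hf zero) (∑-onePoint a (f ∘ suc) x y (hf ∘ suc))) (x∙yz≈y∙xz y x (n * y))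

∑-onePoint₀ : ∀ {n} (a : Fin n) (f : Fin n → ℕ) x →
              (∀ b → f b ≡ (if eqV b a then x else 0)) → sum f ≡ x
∑-onePoint₀ {n} a f x hf =
  trans (∑-onePoint a f x 0 hf) (trans (cong (x +_) (*-zeroʳ (n ∸ 1))) (+-identityʳ x))

∑-twoPoints : ∀ {n} (a b : Fin n) → eqV a b ≡ false → (f : Fin n → ℕ) → ∀ x y z →
              (∀ c → f c ≡ (if eqV c a then x else if eqV c b then y else z)) →
              sum f ≡ x + y + (n ∸ 2) * z
∑-twoPoints {suc n} zero zero () f x y z hf
∑-twoPoints {suc n} zero (suc b) a≢b f x y z hf =
  trans (cong₂ _+_ (hf zero) (∑-onePoint b (f ∘ suc) y z (hf ∘ suc))) (sym (+-assoc x y _))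
∑-twoPoints {suc n} (suc a) zero a≢b f x y z hf =
  trans (cong₂ _+_ (hf zero) (∑-onePoint a (f ∘ suc) x z hf′))
        (trans (x∙yz≈y∙xz y x _) (sym (+-assoc x y _)))
  where
  hf′ : ∀ c → f (suc c) ≡ (if eqV c a then x else z)
  hf′ c with hf (suc c)
  ... | eq with eqV c a
  ... | true  = eq
  ... | false = eq
∑-twoPoints {suc (suc zero)} (suc zero) (suc zero) () f x y z hf
∑-twoPoints {suc (suc (suc n))} (suc a) (suc b) a≢b f x y z hf =
  trans (cong₂ _+_ (hf zero) (∑-twoPoints a b a≢b (f ∘ suc) x y z (hf ∘ suc)))
        (x∙yz≈y∙xz z (x + y) (n * z))

eqV-refl : ∀ {N} (i : Fin N) → eqV i i ≡ true
eqV-refl zero    = refl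
eqV-refl (suc i) = eqV-refl i

eqV-sym : ∀ {N} (i j : Fin N) → eqV i j ≡ eqV j i
eqV-sym zero    zero    = refl
eqV-sym zero    (suc j) = refl
eqV-sym (suc i) zero    = refl
eqV-sym (suc i) (suc j) = eqV-sym i j

eqV⇒≡ : ∀ {N} {i j : Fin N} → eqV i j ≡ true → i ≡ j
eqV⇒≡ {i = i} {j} e = toℕ-injective (≡ᵇ⇒≡ (toℕ i) (toℕ j) (from T-≡ e))

eqV-swap : ∀ {N} (i j : Fin N) → eqV i j ≡ false → eqV j i ≡ false
eqV-swap i j e = trans (eqV-sym j i) e

eqV-notBoth : ∀ {N} (c a b : Fin N) → eqV a b ≡ false → (eqV c a ∧ eqV c b) ≡ false
eqV-notBoth c a b a≢b with eqV c a in e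
... | false = refl
... | true rewrite eqV⇒≡ {i = c} {a} e = a≢b

-- Shortest-path distances

any-allFin⁺ : ∀ {N} (p : Fin N → Bool) (x : Fin N) → p x ≡ true → any p (allFin N) ≡ true
any-allFin⁺ p x px = to T-≡ (any⁺ p (lose (∈-allFin x) (from T-≡ px)))

any-allFin⁻ : ∀ {N} (p : Fin N → Bool) → any p (allFin N) ≡ true → Σ[ x ∈ Fin N ] p x ≡ true
any-allFin⁻ {N} p e with satisfied (any⁻ p (allFin N) (from T-≡ e))
... | x , px = x , to T-≡ px

∧≡true : ∀ {a b} → (a ∧ b) ≡ true → (a ≡ true) × (b ≡ true)
∧≡true {true} {true} e = refl , refl

module DistanceCharacterisation {N} (G : Graph N) (D : Fin N → Fin N → ℕ)
  (D≡0 : ∀ u v → eqV u v ≡ true → D u v ≡ 0)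
  (D≡0⇒eqV : ∀ u v → D u v ≡ 0 → eqV u v ≡ true)
  (D-edge : ∀ u w v → G u w ≡ true → D u v ≤ suc (D w v))
  (D-step : ∀ u v d → D u v ≡ suc d → Σ[ w ∈ Fin N ] G u w ≡ true × D w v ≡ d) where

  reach-sound : ∀ k u v → reach G k u v ≡ true → D u v ≤ k
  reach-sound zero    u v e = ≤-reflexive (D≡0 u v e)
  reach-sound (suc k) u v e with reach G k u v in e₁
  ... | true  = m≤n⇒m≤1+n (reach-sound k u v e₁)
  ... | false with any-allFin⁻ _ e
  ... | w , ew with ∧≡true ew
  ... | uw , wv = ≤-trans (D-edge u w v uw) (s≤s (reach-sound k w v wv))

  reach-complete : ∀ k u v → D u v ≤ k → reach G k u v ≡ true
  reach-complete zero    u v le = D≡0⇒eqV u v (n≤0⇒n≡0 le)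
  reach-complete (suc k) u v le with D u v ≤? k
  ... | yes le′ rewrite reach-complete k u v le′ = refl
  ... | no  gt with D-step u v k (≤-antisym le (≰⇒> gt))
  ... | w , uw , wv with reach G k u v
  ... | true  = refl
  ... | false = any-allFin⁺ (λ w′ → G u w′ ∧ reach G k w′ v) w
                  (subst (λ b → b ∧ reach G k w v ≡ true) (sym uw) (reach-complete k w v (≤-reflexive wv)))

  distSearch≡D : ∀ u v f k → k ≤ D u v → D u v < k + f → distSearch G u v f k ≡ D u v
  distSearch≡D u v zero    k le lt = ⊥-elim (<⇒≱ lt (subst (_≤ D u v) (sym (+-identityʳ k)) le))
  distSearch≡D u v (suc f) k le lt with reach G k u v in e
  ... | true  = ≤-antisym le (reach-sound k u v e)
  ... | false = distSearch≡D u v f (suc k) (≤∧≢⇒< le k≢D) (subst (D u v <_) (+-suc k f) lt)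
    where
    k≢D : k ≢ D u v
    k≢D k≡D with trans (sym (reach-complete k u v (≤-reflexive (sym k≡D)))) e
    ... | ()

  dist≡D : ∀ u v → D u v < N → dist G u v ≡ D u v
  dist≡D u v lt = distSearch≡D u v N 0 z≤n lt

-- Distances in Q(m,n)

isRoot : ∀ {n} → Fin n → Bool
isRoot a = toℕ a ≡ᵇ 0

-- the distance from a vertex of a copy of K_n to the root of that copy
height : Bool → ℕ
height true  = 0
height false = 1

-- the distance between (i,a) and (j,b), given (i = j), (a = b) and the heights of a and b
distShape : Bool → Bool → ℕ → ℕ → ℕ
distShape true  true  _ _  = 0
distShape true  false _ _  = 1
distShape false _     h h′ = suc (h + h′)

height-<ᵇ : ∀ za zb → [ height za <ᵇ height zb ] ≡ [ za ∧ not zb ]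
height-<ᵇ true  true  = refl
height-<ᵇ true  false = refl
height-<ᵇ false true  = refl
height-<ᵇ false false = refl

eqV-root : ∀ {n} (o : Fin n) → isRoot o ≡ true → ∀ b → eqV b o ≡ isRoot b
eqV-root o o-root b = cong (toℕ b ≡ᵇ_) (≡ᵇ⇒≡ (toℕ o) 0 (from T-≡ o-root))

eqV-root′ : ∀ {n} (o : Fin n) → isRoot o ≡ true → ∀ b → eqV o b ≡ isRoot b
eqV-root′ o o-root b = trans (eqV-sym o b) (eqV-root o o-root b)

rootOf : ∀ {n} → Fin n → Fin n
rootOf zero    = zero
rootOf (suc _) = zero

isRoot-rootOf : ∀ {n} (a : Fin n) → isRoot (rootOf a) ≡ true
isRoot-rootOf zero    = refl
isRoot-rootOf (suc a) = refl

module Coordinates (m n : ℕ) where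

  adj : Fin m → Fin n → Fin m → Fin n → Bool
  adj i a j b = (eqV i j ∧ not (eqV a b)) ∨ (not (eqV i j) ∧ isRoot a ∧ isRoot b)

  qDist : Fin m → Fin n → Fin m → Fin n → ℕ
  qDist i a j b = distShape (eqV i j) (eqV a b) (height (isRoot a)) (height (isRoot b))

  adj-sym : ∀ i a j b → adj i a j b ≡ adj j b i a
  adj-sym i a j b rewrite eqV-sym i j | eqV-sym a b | ∧-comm (isRoot a) (isRoot b) = refl

  adj-irrefl : ∀ i a → adj i a i a ≡ false
  adj-irrefl i a rewrite eqV-refl i | eqV-refl a = refl

  qDist≡0⇒ : ∀ i a j b → qDist i a j b ≡ 0 → (eqV i j ≡ true) × (eqV a b ≡ true)
  qDist≡0⇒ i a j b e with eqV i j | eqV a b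
  ... | true  | true  = refl , refl
  ... | true  | false = ⊥-elim (1+n≢0 e)
  ... | false | _     = ⊥-elim (1+n≢0 e)

  height≤1 : ∀ z → height z ≤ 1
  height≤1 true  = z≤n
  height≤1 false = s≤s z≤n

  sameCopy≤1 : ∀ e h h′ → distShape true e h h′ ≤ 1
  sameCopy≤1 true  h h′ = z≤n
  sameCopy≤1 false h h′ = s≤s z≤n

  qDist-edge : ∀ i a l c j b → adj i a l c ≡ true → qDist i a j b ≤ suc (qDist l c j b)
  qDist-edge i a l c j b ac with eqV i l in e₁
  qDist-edge i a l c j b ac | true with eqV⇒≡ {i = i} {l} e₁
  ... | refl with eqV i j
  ... | true  = ≤-trans (sameCopy≤1 _ _ _) (s≤s z≤n)
  ... | false = s≤s (+-monoˡ-≤ (height (isRoot b)) (≤-trans (height≤1 (isRoot a)) (s≤s z≤n)))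
  qDist-edge i a l c j b ac | false with ∧≡true {isRoot a} {isRoot c} ac
  ... | ra , rc with eqV i j
  ... | true  = ≤-trans (sameCopy≤1 _ _ _) (s≤s z≤n)
  ... | false rewrite ra with eqV l j
  ... | false = s≤s (≤-trans (height≤1 (isRoot b)) (s≤s z≤n))
  ... | true with eqV c b in e₃
  ... | false = s≤s (height≤1 (isRoot b))
  ... | true with eqV⇒≡ {i = c} {b} e₃
  ... | refl rewrite rc = s≤s z≤n

  qDist-step : ∀ i a j b d → qDist i a j b ≡ suc d →
               Σ[ l ∈ Fin m ] Σ[ c ∈ Fin n ] adj i a l c ≡ true × qDist l c j b ≡ d
  qDist-step i a j b d e with eqV i j in e₁
  qDist-step i a j b d e | true with eqV a b in e₂
  ... | true  = ⊥-elim (1+n≢0 (sym e))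
  ... | false rewrite eqV⇒≡ {i = i} {j} e₁ = j , b , adj-jb , qDist-jb
    where
    adj-jb : adj j a j b ≡ true
    adj-jb rewrite eqV-refl j | e₂ = refl
    qDist-jb : qDist j b j b ≡ d
    qDist-jb rewrite eqV-refl j | eqV-refl b = suc-injective e
  qDist-step i a j b d e | false = viaRoots (isRoot a) (isRoot b) refl refl
    where
    viaRoots : ∀ za zb → isRoot a ≡ za → isRoot b ≡ zb →
               Σ[ l ∈ Fin m ] Σ[ c ∈ Fin n ] adj i a l c ≡ true × qDist l c j b ≡ d
    viaRoots false _ ra _ = i , rootOf a , adj-i0 , qDist-i0
      where
      adj-i0 : adj i a i (rootOf a) ≡ true
      adj-i0 rewrite eqV-refl i | eqV-root (rootOf a) (isRoot-rootOf a) a | ra = refl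
      qDist-i0 : qDist i (rootOf a) j b ≡ d
      qDist-i0 rewrite e₁ | isRoot-rootOf a = trans (cong (λ z → height z + height (isRoot b)) (sym ra)) (suc-injective e)
    viaRoots true false ra rb = j , rootOf a , adj-j0 , qDist-j0
      where
      adj-j0 : adj i a j (rootOf a) ≡ true
      adj-j0 rewrite e₁ | ra | isRoot-rootOf a = refl
      qDist-j0 : qDist j (rootOf a) j b ≡ d
      qDist-j0 rewrite eqV-refl j | eqV-root′ (rootOf a) (isRoot-rootOf a) b | rb =
        trans (cong (λ z → height z + 1) (sym ra)) (suc-injective e)
    viaRoots true true ra rb = j , b , adj-jb , qDist-jb
      where
      adj-jb : adj i a j b ≡ true
      adj-jb rewrite e₁ | ra | rb = refl
      qDist-jb : qDist j b j b ≡ d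
      qDist-jb rewrite eqV-refl j | eqV-refl b = trans (cong₂ (λ x y → height x + height y) (sym ra) (sym rb)) (suc-injective e)

  private
    1≤size : ∀ {k} (a : Fin k) → 1 ≤ k
    1≤size {suc k} a = s≤s z≤n

    2≤size : ∀ {k} (a b : Fin k) → eqV a b ≡ false → 2 ≤ k
    2≤size {suc zero}    zero zero ()
    2≤size {suc (suc k)} a    b    e = s≤s (s≤s z≤n)

    2≤n : ∀ a → isRoot a ≡ false → 2 ≤ n
    2≤n a ra = 2≤size a (rootOf a) (trans (eqV-root (rootOf a) (isRoot-rootOf a) a) ra)

  qDist<mn : ∀ i a j b → qDist i a j b < m * n
  qDist<mn i a j b with eqV i j in e₁
  ... | true with eqV a b in e₂
  ... | true  = *-mono-≤ (1≤size i) (1≤size a)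
  ... | false = *-mono-≤ (1≤size i) (2≤size a b e₂)
  qDist<mn i a j b | false with isRoot a in ra | isRoot b in rb
  ... | true  | true  = *-mono-≤ (2≤size i j e₁) (1≤size a)
  ... | true  | false = ≤-trans (s≤s (s≤s (s≤s z≤n))) (*-mono-≤ (2≤size i j e₁) (2≤n b rb))
  ... | false | zb    = ≤-trans (s≤s (s≤s (s≤s (height≤1 zb)))) (*-mono-≤ (2≤size i j e₁) (2≤n a ra))

  copy : Fin (m * n) → Fin m
  copy x = proj₁ (remQuot {m} n x)

  place : Fin (m * n) → Fin n
  place x = proj₂ (remQuot {m} n x)

  Q-dist : Fin (m * n) → Fin (m * n) → ℕ
  Q-dist x y = qDist (copy x) (place x) (copy y) (place y)

  private
    Q-dist≡0 : ∀ u v → eqV u v ≡ true → Q-dist u v ≡ 0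
    Q-dist≡0 u v e rewrite eqV⇒≡ {i = u} {v} e | eqV-refl (copy v) | eqV-refl (place v) = refl

    Q-dist≡0⇒ : ∀ u v → Q-dist u v ≡ 0 → eqV u v ≡ true
    Q-dist≡0⇒ u v e with qDist≡0⇒ (copy u) (place u) (copy v) (place v) e
    ... | e₁ , e₂ = subst (λ w → eqV u w ≡ true) u≡v (eqV-refl u)
      where
      u≡v : u ≡ v
      u≡v = trans (sym (combine-remQuot {m} n u))
                  (trans (cong₂ combine (eqV⇒≡ {i = copy u} e₁) (eqV⇒≡ {i = place u} e₂)) (combine-remQuot {m} n v))

    Q-dist-edge : ∀ u w v → Q m n u w ≡ true → Q-dist u v ≤ suc (Q-dist w v)
    Q-dist-edge u w v = qDist-edge (copy u) (place u) (copy w) (place w) (copy v) (place v)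

    Q-dist-step : ∀ u v d → Q-dist u v ≡ suc d → Σ[ w ∈ Fin (m * n) ] Q m n u w ≡ true × Q-dist w v ≡ d
    Q-dist-step u v d e with qDist-step (copy u) (place u) (copy v) (place v) d e
    ... | l , c , uw , wv = combine l c ,
          subst (λ p → adj (copy u) (place u) (proj₁ p) (proj₂ p) ≡ true) (sym (remQuot-combine l c)) uw ,
          subst (λ p → qDist (proj₁ p) (proj₂ p) (copy v) (place v) ≡ d) (sym (remQuot-combine l c)) wv

  open DistanceCharacterisation (Q m n) Q-dist Q-dist≡0 Q-dist≡0⇒ Q-dist-edge Q-dist-step

  dist-combine : ∀ i a j b → dist (Q m n) (combine i a) (combine j b) ≡ qDist i a j b
  dist-combine i a j b =
    trans (dist≡D (combine i a) (combine j b)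
                  (qDist<mn (copy (combine i a)) (place (combine i a)) (copy (combine j b)) (place (combine j b))))
          (cong₂ (λ p q → qDist (proj₁ p) (proj₂ p) (proj₁ q) (proj₂ q)) (remQuot-combine i a) (remQuot-combine j b))

  Q-combine : ∀ i a j b → Q m n (combine i a) (combine j b) ≡ adj i a j b
  Q-combine i a j b =
    cong₂ (λ p q → adj (proj₁ p) (proj₂ p) (proj₁ q) (proj₂ q)) (remQuot-combine i a) (remQuot-combine j b)

<ᵇ≡true : ∀ {x y} → x < y → (x <ᵇ y) ≡ true
<ᵇ≡true x<y = to T-≡ (<⇒<ᵇ x<y)

<ᵇ≡false : ∀ {x y} → ¬ x < y → (x <ᵇ y) ≡ false
<ᵇ≡false {x} {y} x≮y with x <ᵇ y in e
... | false = refl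
... | true  = contradiction (<ᵇ⇒< x y (from T-≡ e)) x≮y

+-cancelˡ-<ᵇ : ∀ x y z → (x + y <ᵇ x + z) ≡ (y <ᵇ z)
+-cancelˡ-<ᵇ zero    y z = refl
+-cancelˡ-<ᵇ (suc x) y z = +-cancelˡ-<ᵇ x y z

if-∧ : ∀ s t (v : ℕ) → (if s ∧ t then v else 0) ≡ (if s then (if t then v else 0) else 0)
if-∧ true  t v = refl
if-∧ false t v = refl

2*ΣE≡∑∑ : ∀ {N} (G : Graph N) → (∀ a b → G a b ≡ G b a) → (∀ a → G a a ≡ false) →
          (f : Fin N → Fin N → ℕ) → (∀ a b → f a b ≡ f b a) →
          2 * ΣE G f ≡ ∑[ a < N ] ∑[ b < N ] (if G a b then f a b else 0)
2*ΣE≡∑∑ {N} G G-sym G-irrefl f f-sym = begin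
  2 * ΣE G f
    ≡⟨ cong (2 *_) ΣE≡∑∑below ⟩
  L + (L + 0)
    ≡⟨ cong (L +_) (trans (+-identityʳ L) (∑-comm below)) ⟩
  L + ∑[ a < N ] ∑[ b < N ] below b a
    ≡⟨ sym (∑-distrib-+ (λ a → ∑[ b < N ] below a b) _) ⟩
  ∑[ a < N ] (∑[ b < N ] below a b + ∑[ b < N ] below b a)
    ≡⟨ sum-cong-≗ (λ a → sym (∑-distrib-+ (below a) (λ b → below b a))) ⟩
  ∑[ a < N ] ∑[ b < N ] (below a b + below b a)
    ≡⟨ sum-cong-≗ (λ a → sum-cong-≗ (λ b → sym (split a b))) ⟩
  ∑[ a < N ] ∑[ b < N ] onEdge a b
    ∎
  where
  open ≡-Reasoning
  onEdge : Fin N → Fin N → ℕ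
  onEdge a b = if G a b then f a b else 0

  below : Fin N → Fin N → ℕ
  below a b = if toℕ a <ᵇ toℕ b then onEdge a b else 0

  L : ℕ
  L = ∑[ a < N ] ∑[ b < N ] below a b

  ΣE≡∑∑below : ΣE G f ≡ L
  ΣE≡∑∑below = trans (ΣV≡∑ (λ a → ΣV (edgeTerm a))) (sum-cong-≗ (λ a →
                 trans (ΣV≡∑ (edgeTerm a)) (sum-cong-≗ (λ b → if-∧ (toℕ a <ᵇ toℕ b) (G a b) (f a b)))))
    where
    edgeTerm : Fin N → Fin N → ℕ
    edgeTerm a b = if (toℕ a <ᵇ toℕ b) ∧ G a b then f a b else 0

  split : ∀ a b → onEdge a b ≡ below a b + below b a
  split a b with <-cmp (toℕ a) (toℕ b)
  ... | tri< a<b _ b≮a rewrite <ᵇ≡true a<b | <ᵇ≡false b≮a = sym (+-identityʳ _)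
  ... | tri> a≮b _ b<a rewrite <ᵇ≡false a≮b | <ᵇ≡true b<a | G-sym a b | f-sym a b = refl
  ... | tri≈ a≮b a≡b _ rewrite toℕ-injective a≡b | G-irrefl b | <ᵇ≡false a≮b = refl

-- The Mostar indices of Q(m,n) as sums over coordinates

module Indices (m n : ℕ) where
  open Coordinates m n

  ∑Q : (Fin m → Fin n → Fin m → Fin n → ℕ) → ℕ
  ∑Q h = ∑[ i < m ] ∑[ a < n ] ∑[ j < m ] ∑[ b < n ] h i a j b

  onAdj : (Fin m → Fin n → Fin m → Fin n → ℕ) → Fin m → Fin n → Fin m → Fin n → ℕ
  onAdj h i a j b = if adj i a j b then h i a j b else 0

  ∑∑≡∑Q : (g : Fin (m * n) → Fin (m * n) → ℕ) →
          ∑[ x < m * n ] ∑[ y < m * n ] g x y ≡ ∑Q (λ i a j b → g (combine i a) (combine j b))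
  ∑∑≡∑Q g = trans (∑-combine m n (λ x → ∑[ y < m * n ] g x y))
                  (sum-cong-≗ {m} (λ i → sum-cong-≗ {n} (λ a → ∑-combine m n (g (combine i a)))))

  onEdges-combine : (g : Fin (m * n) → Fin (m * n) → ℕ) (h : Fin m → Fin n → Fin m → Fin n → ℕ) →
                    (∀ i a j b → g (combine i a) (combine j b) ≡ h i a j b) →
                    ∑[ x < m * n ] ∑[ y < m * n ] (if Q m n x y then g x y else 0) ≡ ∑Q (onAdj h)
  onEdges-combine g h g≡h =
    trans (∑∑≡∑Q (λ x y → if Q m n x y then g x y else 0))
          (sum-cong-≗ {m} λ i → sum-cong-≗ {n} λ a → sum-cong-≗ {m} λ j → sum-cong-≗ {n} λ b →
             cong₂ (λ t v → if t then v else 0) (Q-combine i a j b) (g≡h i a j b))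

  nQ : Fin m → Fin n → Fin m → Fin n → ℕ
  nQ i a j b = ∑[ k < m ] ∑[ c < n ] [ qDist k c i a <ᵇ qDist k c j b ]

  nV-combine : ∀ i a j b → nV (Q m n) (combine i a) (combine j b) ≡ nQ i a j b
  nV-combine i a j b = trans (ΣV≡∑ closer) (trans (∑-combine m n closer) (sum-cong-≗ {m} λ k → sum-cong-≗ {n} λ c →
                         cong₂ (λ x y → [ x <ᵇ y ]) (dist-combine k c i a) (dist-combine k c j b)))
    where
    closer : Fin (m * n) → ℕ
    closer w = [ dist (Q m n) w (combine i a) <ᵇ dist (Q m n) w (combine j b) ]

  Q-sym : ∀ x y → Q m n x y ≡ Q m n y x
  Q-sym x y = adj-sym (copy x) (place x) (copy y) (place y)

  Q-irrefl : ∀ x → Q m n x x ≡ false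
  Q-irrefl x = adj-irrefl (copy x) (place x)

  2*Mo≡ : 2 * Mo (Q m n) ≡ ∑Q (onAdj (λ i a j b → ∣ nQ i a j b - nQ j b i a ∣))
  2*Mo≡ = trans (2*ΣE≡∑∑ (Q m n) Q-sym Q-irrefl f (λ x y → ∣-∣-comm (nV (Q m n) x y) (nV (Q m n) y x)))
                (onEdges-combine f _ (λ i a j b → cong₂ ∣_-_∣ (nV-combine i a j b) (nV-combine j b i a)))
    where
    f : Fin (m * n) → Fin (m * n) → ℕ
    f x y = ∣ nV (Q m n) x y - nV (Q m n) y x ∣

  closerEdge : Fin m → Fin n → Fin m → Fin n → Fin m → Fin n → Fin m → Fin n → ℕ
  closerEdge i a j b l p l′ q = [ (qDist i a l p ⊓ qDist i a l′ q) <ᵇ (qDist j b l p ⊓ qDist j b l′ q) ]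

  -- twice m_u(e): ∑Q runs over ordered pairs of adjacent vertices, so it sees every edge twice
  mQ : Fin m → Fin n → Fin m → Fin n → ℕ
  mQ i a j b = ∑Q (onAdj (closerEdge i a j b))

  2*mE-combine : ∀ i a j b → 2 * mE (Q m n) (combine i a) (combine j b) ≡ mQ i a j b
  2*mE-combine i a j b =
    trans (2*ΣE≡∑∑ (Q m n) Q-sym Q-irrefl f f-sym)
          (onEdges-combine f _ (λ l p l′ q → cong₂ (λ s t → [ s <ᵇ t ])
             (cong₂ _⊓_ (dist-combine i a l p) (dist-combine i a l′ q))
             (cong₂ _⊓_ (dist-combine j b l p) (dist-combine j b l′ q))))
    where
    x y : Fin (m * n)
    x = combine i a
    y = combine j b
    f : Fin (m * n) → Fin (m * n) → ℕ
    f u v = [ distE (Q m n) x u v <ᵇ distE (Q m n) y u v ]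
    f-sym : ∀ u v → f u v ≡ f v u
    f-sym u v = cong₂ (λ s t → [ s <ᵇ t ]) (⊓-comm (dist (Q m n) x u) (dist (Q m n) x v))
                                          (⊓-comm (dist (Q m n) y u) (dist (Q m n) y v))

  4*Moe≡ : 2 * (2 * Moe (Q m n)) ≡ ∑Q (onAdj (λ i a j b → ∣ mQ i a j b - mQ j b i a ∣))
  4*Moe≡ = begin
    2 * (2 * Moe (Q m n))
      ≡⟨ cong (2 *_) (2*ΣE≡∑∑ (Q m n) Q-sym Q-irrefl f f-sym) ⟩
    2 * (∑[ x < m * n ] ∑[ y < m * n ] onEdge f x y)
      ≡⟨ *-distribˡ-sum 2 (λ x → ∑[ y < m * n ] onEdge f x y) ⟩
    ∑[ x < m * n ] (2 * ∑[ y < m * n ] onEdge f x y)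
      ≡⟨ sum-cong-≗ {m * n} (λ x → *-distribˡ-sum 2 (onEdge f x)) ⟩
    ∑[ x < m * n ] ∑[ y < m * n ] (2 * onEdge f x y)
      ≡⟨ sum-cong-≗ {m * n} (λ x → sum-cong-≗ {m * n} (λ y → *-if 2 (Q m n x y) (f x y))) ⟩
    ∑[ x < m * n ] ∑[ y < m * n ] onEdge (λ u v → 2 * f u v) x y
      ≡⟨ onEdges-combine (λ u v → 2 * f u v) _ 2*f-combine ⟩
    ∑Q (onAdj (λ i a j b → ∣ mQ i a j b - mQ j b i a ∣))
      ∎
    where
    open ≡-Reasoning
    f : Fin (m * n) → Fin (m * n) → ℕ
    f x y = ∣ mE (Q m n) x y - mE (Q m n) y x ∣
    f-sym : ∀ x y → f x y ≡ f y x
    f-sym x y = ∣-∣-comm (mE (Q m n) x y) (mE (Q m n) y x)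
    onEdge : (Fin (m * n) → Fin (m * n) → ℕ) → Fin (m * n) → Fin (m * n) → ℕ
    onEdge g x y = if Q m n x y then g x y else 0
    *-if : ∀ c t v → c * (if t then v else 0) ≡ (if t then c * v else 0)
    *-if c true  v = refl
    *-if c false v = *-zeroʳ c
    2*f-combine : ∀ i a j b → 2 * f (combine i a) (combine j b) ≡ ∣ mQ i a j b - mQ j b i a ∣
    2*f-combine i a j b = trans (*-distribˡ-∣-∣ 2 (mE (Q m n) (combine i a) (combine j b)) _)
                                (cong₂ ∣_-_∣ (2*mE-combine i a j b) (2*mE-combine j b i a))

module EdgeSums (m n : ℕ) (o : Fin n) (o-root : isRoot o ≡ true) where
  open Coordinates m n
  open Indices m n

  ∑Q-onAdj : (V : Fin m → Fin n → Fin m → Fin n → ℕ) (K : ℕ) →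
             (∀ i a b → eqV a b ≡ false → V i a i b ≡ (if isRoot a xor isRoot b then K else 0)) →
             (∀ i j a b → eqV i j ≡ false → isRoot a ≡ true → isRoot b ≡ true → V i a j b ≡ 0) →
             ∑Q (onAdj V) ≡ 2 * (m * ((n ∸ 1) * K))
  ∑Q-onAdj V K V-inCopy V-roots = begin
    ∑Q (onAdj V)
      ≡⟨ sum-cong-≗ {m} (λ i → sum-cong-≗ {n} (λ a → ∑-onePoint₀ i (inner i a) (inner i a i) (inner-offCopy i a))) ⟩
    ∑[ i < m ] ∑[ a < n ] inner i a i
      ≡⟨ sum-cong-≗ {m} (λ i → sum-cong-≗ {n} (inner-inCopy i)) ⟩
    ∑[ i < m ] ∑[ a < n ] (if isRoot a then 0 + (n ∸ 1) * K else K)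
      ≡⟨ sum-cong-≗ {m} (λ i → ∑-onePoint o _ _ _ atRoot) ⟩
    ∑[ i < m ] ((n ∸ 1) * K + (n ∸ 1) * K)
      ≡⟨ ∑-const m _ ⟩
    m * ((n ∸ 1) * K + (n ∸ 1) * K)
      ≡⟨ double m ((n ∸ 1) * K) ⟩
    2 * (m * ((n ∸ 1) * K))
      ∎
    where
    open ≡-Reasoning
    double : ∀ x y → x * (y + y) ≡ 2 * (x * y)
    double = solve-∀

    atRoot : ∀ a → (if isRoot a then 0 + (n ∸ 1) * K else K) ≡ (if eqV a o then 0 + (n ∸ 1) * K else K)
    atRoot a rewrite eqV-root o o-root a = refl

    inner : Fin m → Fin n → Fin m → ℕ
    inner i a j = ∑[ b < n ] onAdj V i a j b

    inner-offCopy : ∀ i a j → inner i a j ≡ (if eqV j i then inner i a i else 0)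
    inner-offCopy i a j with eqV j i in e
    ... | true rewrite eqV⇒≡ {i = j} {i} e = refl
    ... | false = ∑-zero _ offCopy
      where
      offCopy : ∀ b → (if adj i a j b then V i a j b else 0) ≡ 0
      offCopy b rewrite eqV-swap j i e with isRoot a in ra | isRoot b in rb
      ... | true  | true  = V-roots i j a b (eqV-swap j i e) ra rb
      ... | true  | false = refl
      ... | false | _     = refl

    inner-fromRoot : ∀ i a → isRoot a ≡ true → inner i a i ≡ 0 + (n ∸ 1) * K
    inner-fromRoot i a ra = ∑-onePoint a _ 0 K fromRoot
      where
      fromRoot : ∀ b → (if adj i a i b then V i a i b else 0) ≡ (if eqV b a then 0 else K)
      fromRoot b with eqV b a in e
      ... | true rewrite eqV⇒≡ {i = b} {a} e | eqV-refl i | eqV-refl a = refl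
      ... | false rewrite eqV-refl i | eqV-swap b a e | V-inCopy i a b (eqV-swap b a e) | ra
                        | trans (sym (eqV-root a ra b)) e = refl

    inner-fromLeaf : ∀ i a → isRoot a ≡ false → inner i a i ≡ K
    inner-fromLeaf i a ra = ∑-onePoint₀ o _ K fromLeaf
      where
      fromLeaf : ∀ b → (if adj i a i b then V i a i b else 0) ≡ (if eqV b o then K else 0)
      fromLeaf b rewrite eqV-root o o-root b with eqV a b in e
      ... | true rewrite eqV⇒≡ {i = a} {b} e | eqV-refl i | ra = refl
      ... | false rewrite eqV-refl i | V-inCopy i a b e | ra = refl

    inner-inCopy : ∀ i a → inner i a i ≡ (if isRoot a then 0 + (n ∸ 1) * K else K)
    inner-inCopy i a = byRoot (isRoot a) refl
      where
      byRoot : ∀ z → isRoot a ≡ z → inner i a i ≡ (if z then 0 + (n ∸ 1) * K else K)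
      byRoot true  ra = inner-fromRoot i a ra
      byRoot false ra = inner-fromLeaf i a ra

∣-rootToLeaf : ∀ y K za zb → ∣ y + [ za ∧ not zb ] * K - (y + [ zb ∧ not za ] * K) ∣ ≡ (if za xor zb then K else 0)
∣-rootToLeaf y K za zb = trans (∣m+n-m+o∣≡∣n-o∣ y _ _) (byRoots za zb)
  where
  byRoots : ∀ za zb → ∣ [ za ∧ not zb ] * K - [ zb ∧ not za ] * K ∣ ≡ (if za xor zb then K else 0)
  byRoots true  true  = refl
  byRoots true  false = trans (∣-∣-identityʳ (K + 0)) (+-identityʳ K)
  byRoots false true  = +-identityʳ K
  byRoots false false = refl

-- Vertex counts

module VertexCounts (m n : ℕ) (o : Fin n) (o-root : isRoot o ≡ true) where
  open Coordinates m n
  open Indices m n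

  nQ-inCopy : ∀ i a b → eqV a b ≡ false → nQ i a i b ≡ 1 + [ isRoot a ∧ not (isRoot b) ] * ((m ∸ 1) * n)
  nQ-inCopy i a b a≢b = trans (∑-onePoint i _ _ _ byCopy) (arith (n ∸ 1) (m ∸ 1) n [ isRoot a ∧ not (isRoot b) ])
    where
    arith : ∀ N M n c → 1 + N * 0 + M * (n * c) ≡ 1 + c * (M * n)
    arith = solve-∀

    inOwnCopy : ∀ c → [ distShape true (eqV c a) (height (isRoot c)) (height (isRoot a))
                        <ᵇ distShape true (eqV c b) (height (isRoot c)) (height (isRoot b)) ]
                      ≡ (if eqV c a then 1 else 0)
    inOwnCopy c with eqV c a in e
    ... | true rewrite eqV⇒≡ {i = c} {a} e | a≢b = refl
    ... | false with eqV c b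
    ... | true  = refl
    ... | false = refl

    inOtherCopy : ∀ c → [ suc (height (isRoot c) + height (isRoot a)) <ᵇ suc (height (isRoot c) + height (isRoot b)) ]
                        ≡ [ isRoot a ∧ not (isRoot b) ]
    inOtherCopy c = trans (cong [_] (+-cancelˡ-<ᵇ (height (isRoot c)) _ _)) (height-<ᵇ (isRoot a) (isRoot b))

    byCopy : ∀ k → ∑[ c < n ] [ qDist k c i a <ᵇ qDist k c i b ]
                   ≡ (if eqV k i then 1 + (n ∸ 1) * 0 else n * [ isRoot a ∧ not (isRoot b) ])
    byCopy k with eqV k i
    ... | true  = ∑-onePoint a _ 1 0 inOwnCopy
    ... | false = trans (sum-cong-≗ {n} inOtherCopy) (∑-const n _)

  -- Only the vertices of copy i are closer to (i,a) than to (j,b).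
  nQ-roots : ∀ i j a b → eqV i j ≡ false → isRoot a ≡ true → isRoot b ≡ true → nQ i a j b ≡ n
  nQ-roots i j a b i≢j ra rb = trans (∑-onePoint i _ _ _ byCopy) (arith n (m ∸ 1))
    where
    arith : ∀ n M → n * 1 + M * (n * 0) ≡ n
    arith = solve-∀

    closerToRoot : ∀ eki ekj zc → (eki ∧ ekj) ≡ false →
                   [ distShape eki zc (height zc) 0 <ᵇ distShape ekj zc (height zc) 0 ] ≡ [ eki ]
    closerToRoot true  true  zc    ()
    closerToRoot true  false true  _ = refl
    closerToRoot true  false false _ = refl
    closerToRoot false true  true  _ = refl
    closerToRoot false true  false _ = refl
    closerToRoot false false true  _ = refl
    closerToRoot false false false _ = refl

    byCopy : ∀ k → ∑[ c < n ] [ qDist k c i a <ᵇ qDist k c j b ] ≡ (if eqV k i then n * 1 else n * 0)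
    byCopy k = trans (sum-cong-≗ {n} byVertex) (trans (∑-const n _) (byIndicator (eqV k i)))
      where
      byVertex : ∀ c → [ qDist k c i a <ᵇ qDist k c j b ] ≡ [ eqV k i ]
      byVertex c rewrite eqV-root a ra c | eqV-root b rb c | ra | rb =
        closerToRoot (eqV k i) (eqV k j) (isRoot c) (eqV-notBoth k i j i≢j)
      byIndicator : ∀ t → n * [ t ] ≡ (if t then n * 1 else n * 0)
      byIndicator true  = refl
      byIndicator false = refl

Mo-Q : ∀ m n (o : Fin n) → isRoot o ≡ true → Mo (Q m n) ≡ m * n * (m ∸ 1) * (n ∸ 1)
Mo-Q m n o o-root = *-cancelˡ-≡ _ _ 2 (begin
  2 * Mo (Q m n)                              ≡⟨ 2*Mo≡ ⟩
  ∑Q (onAdj V)                                ≡⟨ ∑Q-onAdj V ((m ∸ 1) * n) V-inCopy V-roots ⟩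
  2 * (m * ((n ∸ 1) * ((m ∸ 1) * n)))         ≡⟨ arith m n (m ∸ 1) (n ∸ 1) ⟩
  2 * (m * n * (m ∸ 1) * (n ∸ 1))             ∎)
  where
  open ≡-Reasoning
  open Coordinates m n
  open Indices m n
  open EdgeSums m n o o-root
  open VertexCounts m n o o-root

  arith : ∀ m n M N → 2 * (m * (N * (M * n))) ≡ 2 * (m * n * M * N)
  arith = solve-∀

  V : Fin m → Fin n → Fin m → Fin n → ℕ
  V i a j b = ∣ nQ i a j b - nQ j b i a ∣

  V-inCopy : ∀ i a b → eqV a b ≡ false → V i a i b ≡ (if isRoot a xor isRoot b then (m ∸ 1) * n else 0)
  V-inCopy i a b a≢b = trans (cong₂ ∣_-_∣ (nQ-inCopy i a b a≢b) (nQ-inCopy i b a (eqV-swap a b a≢b)))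
                             (∣-rootToLeaf 1 _ (isRoot a) (isRoot b))

  V-roots : ∀ i j a b → eqV i j ≡ false → isRoot a ≡ true → isRoot b ≡ true → V i a j b ≡ 0
  V-roots i j a b i≢j ra rb rewrite nQ-roots i j a b i≢j ra rb | nQ-roots j i b a (eqV-swap i j i≢j) rb ra =
    ∣n-n∣≡0 n

-- Edge counts

module EdgeCounts (m n : ℕ) (o : Fin n) (o-root : isRoot o ≡ true) where
  open Coordinates m n
  open Indices m n

  module InCopy (i : Fin m) (a b : Fin n) (a≢b : eqV a b ≡ false) where

    c : ℕ
    c = [ isRoot a ∧ not (isRoot b) ]

    closer : Fin m → Fin n → Fin m → ℕ
    closer l p l′ = ∑[ q < n ] onAdj (closerEdge i a i b) l p l′ q

    crossEdge-closer : ∀ eil eil′ za zb →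
      [ (distShape eil za (height za) 0 ⊓ distShape eil′ za (height za) 0)
        <ᵇ (distShape eil zb (height zb) 0 ⊓ distShape eil′ zb (height zb) 0) ] ≡ [ za ∧ not zb ]
    crossEdge-closer true  true  true  true  = refl
    crossEdge-closer true  true  true  false = refl
    crossEdge-closer true  true  false true  = refl
    crossEdge-closer true  true  false false = refl
    crossEdge-closer true  false true  true  = refl
    crossEdge-closer true  false true  false = refl
    crossEdge-closer true  false false true  = refl
    crossEdge-closer true  false false false = refl
    crossEdge-closer false true  true  true  = refl
    crossEdge-closer false true  true  false = refl
    crossEdge-closer false true  false true  = refl
    crossEdge-closer false true  false false = refl
    crossEdge-closer false false true  true  = refl
    crossEdge-closer false false true  false = refl
    crossEdge-closer false false false true  = refl
    crossEdge-closer false false false false = refl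

    closer-cross : ∀ l p l′ → eqV l′ l ≡ false → closer l p l′ ≡ (if isRoot p then c else 0)
    closer-cross l p l′ l′≢l = ∑-onePoint₀ o _ _ byEnd
      where
      byEnd : ∀ q → onAdj (closerEdge i a i b) l p l′ q ≡ (if eqV q o then (if isRoot p then c else 0) else 0)
      byEnd q rewrite eqV-root o o-root q | eqV-swap l′ l l′≢l with isRoot p in rp | isRoot q in rq
      ... | true  | true  rewrite eqV-root p rp a | eqV-root q rq a | eqV-root p rp b | eqV-root q rq b
                                  = crossEdge-closer (eqV i l) (eqV i l′) (isRoot a) (isRoot b)
      ... | true  | false = refl
      ... | false | true  = refl
      ... | false | false = refl

    otherCopyEdge-closer : ∀ epq za zb zp zq eap eaq ebp ebq →
      (if not epq ∨ false then [ (distShape false eap (height za) (height zp) ⊓ distShape false eaq (height za) (height zq))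
                                 <ᵇ (distShape false ebp (height zb) (height zp) ⊓ distShape false ebq (height zb) (height zq)) ]
                          else 0)
      ≡ (if epq then 0 else [ za ∧ not zb ])
    otherCopyEdge-closer true  za    zb    zp    zq    _ _ _ _ = refl
    otherCopyEdge-closer false true  true  true  true  _ _ _ _ = refl
    otherCopyEdge-closer false true  true  true  false _ _ _ _ = refl
    otherCopyEdge-closer false true  true  false true  _ _ _ _ = refl
    otherCopyEdge-closer false true  true  false false _ _ _ _ = refl
    otherCopyEdge-closer false true  false true  true  _ _ _ _ = refl
    otherCopyEdge-closer false true  false true  false _ _ _ _ = refl
    otherCopyEdge-closer false true  false false true  _ _ _ _ = refl
    otherCopyEdge-closer false true  false false false _ _ _ _ = refl
    otherCopyEdge-closer false false true  true  true  _ _ _ _ = refl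
    otherCopyEdge-closer false false true  true  false _ _ _ _ = refl
    otherCopyEdge-closer false false true  false true  _ _ _ _ = refl
    otherCopyEdge-closer false false true  false false _ _ _ _ = refl
    otherCopyEdge-closer false false false true  true  _ _ _ _ = refl
    otherCopyEdge-closer false false false true  false _ _ _ _ = refl
    otherCopyEdge-closer false false false false true  _ _ _ _ = refl
    otherCopyEdge-closer false false false false false _ _ _ _ = refl

    closer-otherCopy : ∀ l p → eqV l i ≡ false → closer l p l ≡ (n ∸ 1) * c
    closer-otherCopy l p l≢i = ∑-onePoint p _ 0 c byEnd
      where
      byEnd : ∀ q → onAdj (closerEdge i a i b) l p l q ≡ (if eqV q p then 0 else c)
      byEnd q rewrite eqV-refl l | eqV-sym p q | eqV-swap l i l≢i =
        otherCopyEdge-closer (eqV q p) (isRoot a) (isRoot b) (isRoot p) (isRoot q) (eqV a p) (eqV a q) (eqV b p) (eqV b q)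

    closer-a : closer i a i ≡ (n ∸ 2) * 1
    closer-a = ∑-twoPoints a b a≢b _ 0 0 1 byEnd
      where
      byEnd : ∀ q → onAdj (closerEdge i a i b) i a i q ≡ (if eqV q a then 0 else if eqV q b then 0 else 1)
      byEnd q rewrite eqV-refl i | eqV-refl a | eqV-swap a b a≢b | eqV-sym a q | eqV-sym b q with eqV q a
      ... | true = refl
      ... | false with eqV q b
      ... | true  = refl
      ... | false = refl

    closer-b : closer i b i ≡ 0
    closer-b = ∑-zero _ byEnd
      where
      byEnd : ∀ q → onAdj (closerEdge i a i b) i b i q ≡ 0
      byEnd q rewrite eqV-refl i | eqV-refl b with eqV b q
      ... | true  = refl
      ... | false = refl

    closer-other : ∀ p → eqV p a ≡ false → eqV p b ≡ false → closer i p i ≡ 1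
    closer-other p p≢a p≢b = trans (∑-twoPoints p a p≢a _ 0 1 0 byEnd) (cong (1 +_) (*-zeroʳ (n ∸ 2)))
      where
      byEnd : ∀ q → onAdj (closerEdge i a i b) i p i q ≡ (if eqV q p then 0 else if eqV q a then 1 else 0)
      byEnd q rewrite eqV-refl i | eqV-swap p a p≢a | eqV-swap p b p≢b | eqV-sym p q | eqV-sym a q | eqV-sym b q
        with eqV q p | eqV q a in qa | eqV q b in qb
      ... | true  | _     | _     = refl
      ... | false | true  | false = refl
      ... | false | false | true  = refl
      ... | false | false | false = refl
      ... | false | true  | true  with trans (sym (cong₂ _∧_ qa qb)) (eqV-notBoth q a b a≢b)
      ... | ()

    closer-fromVertex : ∀ l p → ∑[ l′ < m ] closer l p l′ ≡ closer l p l + (m ∸ 1) * (if isRoot p then c else 0)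
    closer-fromVertex l p = ∑-onePoint l _ _ _ byCopy
      where
      byCopy : ∀ l′ → closer l p l′ ≡ (if eqV l′ l then closer l p l else (if isRoot p then c else 0))
      byCopy l′ with eqV l′ l in e
      ... | true rewrite eqV⇒≡ {i = l′} {l} e = refl
      ... | false = closer-cross l p l′ e

    ownCopyCount : ℕ
    ownCopyCount = (n ∸ 2) * 1 + 0 + (n ∸ 2) * 1

    otherCopyCount : ℕ
    otherCopyCount = n * ((n ∸ 1) * c)

    closer-withinCopy : ∀ l → ∑[ p < n ] closer l p l ≡ (if eqV l i then ownCopyCount else otherCopyCount)
    closer-withinCopy l with eqV l i in e
    ... | true rewrite eqV⇒≡ {i = l} {i} e = ∑-twoPoints a b a≢b _ _ _ _ byVertex
      where
      byVertex : ∀ p → closer i p i ≡ (if eqV p a then (n ∸ 2) * 1 else if eqV p b then 0 else 1)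
      byVertex p with eqV p a in pa
      ... | true rewrite eqV⇒≡ {i = p} {a} pa = closer-a
      ... | false with eqV p b in pb
      ... | true rewrite eqV⇒≡ {i = p} {b} pb = closer-b
      ... | false = closer-other p pa pb
    ... | false = trans (sum-cong-≗ {n} (λ p → closer-otherCopy l p e)) (∑-const n _)

    closer-fromCopy : ∀ l → ∑[ p < n ] ∑[ l′ < m ] closer l p l′
                            ≡ (if eqV l i then ownCopyCount else otherCopyCount) + (m ∸ 1) * c
    closer-fromCopy l = begin
      ∑[ p < n ] ∑[ l′ < m ] closer l p l′
        ≡⟨ sum-cong-≗ {n} (closer-fromVertex l) ⟩
      ∑[ p < n ] (closer l p l + (m ∸ 1) * atRoot p)
        ≡⟨ ∑-distrib-+ (λ p → closer l p l) (λ p → (m ∸ 1) * atRoot p) ⟩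
      ∑[ p < n ] closer l p l + ∑[ p < n ] ((m ∸ 1) * atRoot p)
        ≡⟨ cong₂ _+_ (closer-withinCopy l) (sym (*-distribˡ-sum {n} (m ∸ 1) atRoot)) ⟩
      withinCopy + (m ∸ 1) * ∑[ p < n ] atRoot p
        ≡⟨ cong (λ x → withinCopy + (m ∸ 1) * x) (∑-onePoint₀ o atRoot c byVertex) ⟩
      withinCopy + (m ∸ 1) * c
        ∎
      where
      open ≡-Reasoning
      withinCopy : ℕ
      withinCopy = if eqV l i then ownCopyCount else otherCopyCount
      atRoot : Fin n → ℕ
      atRoot p = if isRoot p then c else 0
      byVertex : ∀ p → atRoot p ≡ (if eqV p o then c else 0)
      byVertex p rewrite eqV-root o o-root p = refl

    mQ-inCopy : mQ i a i b ≡ ownCopyCount + c * ((m ∸ 1) + (m ∸ 1) * (n * (n ∸ 1) + (m ∸ 1)))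
    mQ-inCopy = begin
      mQ i a i b
        ≡⟨ sum-cong-≗ {m} closer-fromCopy ⟩
      ∑[ l < m ] ((if eqV l i then ownCopyCount else otherCopyCount) + (m ∸ 1) * c)
        ≡⟨ ∑-onePoint i _ _ _ byCopy ⟩
      (ownCopyCount + (m ∸ 1) * c) + (m ∸ 1) * (otherCopyCount + (m ∸ 1) * c)
        ≡⟨ arith ownCopyCount (m ∸ 1) (n ∸ 1) n c ⟩
      ownCopyCount + c * ((m ∸ 1) + (m ∸ 1) * (n * (n ∸ 1) + (m ∸ 1)))
        ∎
      where
      open ≡-Reasoning
      arith : ∀ y M N n c → (y + M * c) + M * (n * (N * c) + M * c) ≡ y + c * (M + M * (n * N + M))
      arith = solve-∀
      byCopy : ∀ l → (if eqV l i then ownCopyCount else otherCopyCount) + (m ∸ 1) * c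
                     ≡ (if eqV l i then ownCopyCount + (m ∸ 1) * c else otherCopyCount + (m ∸ 1) * c)
      byCopy l with eqV l i
      ... | true  = refl
      ... | false = refl

  module BetweenRoots (i j : Fin m) (a b : Fin n) (i≢j : eqV i j ≡ false)
                      (ra : isRoot a ≡ true) (rb : isRoot b ≡ true) where

    closer : Fin m → Fin n → Fin m → ℕ
    closer l p l′ = ∑[ q < n ] onAdj (closerEdge i a j b) l p l′ q

    -- for l ≠ l′: whether the edge joining the roots of copies l and l′ is closer to (i,a) than to (j,b)
    towards-i : Fin m → Fin m → ℕ
    towards-i l l′ = [ not (eqV j l ∨ eqV j l′) ∧ (eqV i l ∨ eqV i l′) ]

    j≢i : eqV j i ≡ false
    j≢i = eqV-swap i j i≢j

    if-0 : ∀ t → (if t then 0 else 0) ≡ 0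
    if-0 true  = refl
    if-0 false = refl

    copyEdge-closer : ∀ epq eil ejl zp zq → (eil ∧ ejl) ≡ false →
      (if not epq ∨ false then [ (distShape eil zp 0 (height zp) ⊓ distShape eil zq 0 (height zq))
                                 <ᵇ (distShape ejl zp 0 (height zp) ⊓ distShape ejl zq 0 (height zq)) ]
                          else 0)
      ≡ (if epq then 0 else [ eil ])
    copyEdge-closer true  eil   ejl   zp    zq    _ = refl
    copyEdge-closer false true  true  zp    zq    ()
    copyEdge-closer false true  false true  true  _ = refl
    copyEdge-closer false true  false true  false _ = refl
    copyEdge-closer false true  false false true  _ = refl
    copyEdge-closer false true  false false false _ = refl
    copyEdge-closer false false true  true  true  _ = refl
    copyEdge-closer false false true  true  false _ = refl
    copyEdge-closer false false true  false true  _ = refl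
    copyEdge-closer false false true  false false _ = refl
    copyEdge-closer false false false true  true  _ = refl
    copyEdge-closer false false false true  false _ = refl
    copyEdge-closer false false false false true  _ = refl
    copyEdge-closer false false false false false _ = refl

    crossEdge-closer : ∀ eil eil′ ejl ejl′ →
      [ (distShape eil true 0 0 ⊓ distShape eil′ true 0 0) <ᵇ (distShape ejl true 0 0 ⊓ distShape ejl′ true 0 0) ]
      ≡ [ not (ejl ∨ ejl′) ∧ (eil ∨ eil′) ]
    crossEdge-closer true  true  true  true  = refl
    crossEdge-closer true  true  true  false = refl
    crossEdge-closer true  true  false true  = refl
    crossEdge-closer true  true  false false = refl
    crossEdge-closer true  false true  true  = refl
    crossEdge-closer true  false true  false = refl
    crossEdge-closer true  false false true  = refl
    crossEdge-closer true  false false false = refl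
    crossEdge-closer false true  true  true  = refl
    crossEdge-closer false true  true  false = refl
    crossEdge-closer false true  false true  = refl
    crossEdge-closer false true  false false = refl
    crossEdge-closer false false true  true  = refl
    crossEdge-closer false false true  false = refl
    crossEdge-closer false false false true  = refl
    crossEdge-closer false false false false = refl

    closer-withinCopy : ∀ l p → closer l p l ≡ (n ∸ 1) * [ eqV i l ]
    closer-withinCopy l p = ∑-onePoint p _ 0 _ byEnd
      where
      byEnd : ∀ q → onAdj (closerEdge i a j b) l p l q ≡ (if eqV q p then 0 else [ eqV i l ])
      byEnd q rewrite eqV-refl l | eqV-sym p q | eqV-root′ a ra p | eqV-root′ a ra q | eqV-root′ b rb p
                    | eqV-root′ b rb q | ra | rb =
        copyEdge-closer (eqV q p) (eqV i l) (eqV j l) (isRoot p) (isRoot q)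
                   (trans (cong₂ _∧_ (eqV-sym i l) (eqV-sym j l)) (eqV-notBoth l i j i≢j))

    closer-cross : ∀ l p l′ → eqV l′ l ≡ false → closer l p l′ ≡ (if isRoot p then towards-i l l′ else 0)
    closer-cross l p l′ l′≢l = ∑-onePoint₀ o _ _ byEnd
      where
      byEnd : ∀ q → onAdj (closerEdge i a j b) l p l′ q ≡ (if eqV q o then (if isRoot p then towards-i l l′ else 0) else 0)
      byEnd q rewrite eqV-root o o-root q | eqV-swap l′ l l′≢l with isRoot p in rp | isRoot q in rq
      ... | true  | true  rewrite trans (eqV-root p rp a) ra | trans (eqV-root q rq a) ra
                                | trans (eqV-root p rp b) rb | trans (eqV-root q rq b) rb | ra | rb
                                  = crossEdge-closer (eqV i l) (eqV i l′) (eqV j l) (eqV j l′)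
      ... | true  | false = refl
      ... | false | true  = refl
      ... | false | false = refl

    closer-fromCopy-i : ∀ p → ∑[ l′ < m ] closer i p l′ ≡ (n ∸ 1) * 1 + 0 + (m ∸ 2) * (if isRoot p then 1 else 0)
    closer-fromCopy-i p = ∑-twoPoints i j i≢j _ _ _ _ byCopy
      where
      byCopy : ∀ l′ → closer i p l′
                      ≡ (if eqV l′ i then (n ∸ 1) * 1 else if eqV l′ j then 0 else (if isRoot p then 1 else 0))
      byCopy l′ with eqV l′ i in e
      ... | true rewrite eqV⇒≡ {i = l′} {i} e = trans (closer-withinCopy i p) (cong (λ t → (n ∸ 1) * [ t ]) (eqV-refl i))
      ... | false with eqV l′ j in e′
      ... | true rewrite eqV⇒≡ {i = l′} {j} e′ = trans (closer-cross i p j e) toJ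
        where
        toJ : (if isRoot p then towards-i i j else 0) ≡ 0
        toJ rewrite eqV-refl j | j≢i = if-0 (isRoot p)
      ... | false = trans (closer-cross i p l′ e) elsewhere
        where
        elsewhere : (if isRoot p then towards-i i l′ else 0) ≡ (if isRoot p then 1 else 0)
        elsewhere rewrite j≢i | eqV-swap l′ j e′ | eqV-refl i = refl

    closer-fromCopy-j : ∀ p → ∑[ l′ < m ] closer j p l′ ≡ 0
    closer-fromCopy-j p = ∑-zero _ byCopy
      where
      byCopy : ∀ l′ → closer j p l′ ≡ 0
      byCopy l′ with eqV l′ j in e
      ... | true rewrite eqV⇒≡ {i = l′} {j} e =
        trans (closer-withinCopy j p) (trans (cong (λ t → (n ∸ 1) * [ t ]) i≢j) (*-zeroʳ (n ∸ 1)))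
      ... | false = trans (closer-cross j p l′ e) fromJ
        where
        fromJ : (if isRoot p then towards-i j l′ else 0) ≡ 0
        fromJ rewrite eqV-refl j = if-0 (isRoot p)

    closer-fromCopy-other : ∀ l p → eqV l i ≡ false → eqV l j ≡ false →
                            ∑[ l′ < m ] closer l p l′ ≡ (if isRoot p then 1 else 0)
    closer-fromCopy-other l p l≢i l≢j = ∑-onePoint₀ i _ _ byCopy
      where
      i≢l : eqV i l ≡ false
      i≢l = eqV-swap l i l≢i
      j≢l : eqV j l ≡ false
      j≢l = eqV-swap l j l≢j
      byCopy : ∀ l′ → closer l p l′ ≡ (if eqV l′ i then (if isRoot p then 1 else 0) else 0)
      byCopy l′ with eqV l′ i in e
      ... | true rewrite eqV⇒≡ {i = l′} {i} e = trans (closer-cross l p i i≢l) toI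
        where
        toI : (if isRoot p then towards-i l i else 0) ≡ (if isRoot p then 1 else 0)
        toI rewrite j≢l | j≢i | i≢l | eqV-refl i = refl
      ... | false with eqV l′ l in e′
      ... | true rewrite eqV⇒≡ {i = l′} {l} e′ =
        trans (closer-withinCopy l p) (trans (cong (λ t → (n ∸ 1) * [ t ]) i≢l) (*-zeroʳ (n ∸ 1)))
      ... | false = trans (closer-cross l p l′ e′) elsewhere
        where
        elsewhere : (if isRoot p then towards-i l l′ else 0) ≡ 0
        elsewhere rewrite j≢l | i≢l | eqV-swap l′ i e with eqV j l′
        ... | true  = if-0 (isRoot p)
        ... | false = if-0 (isRoot p)

    mQ-roots : mQ i a j b ≡ (n ∸ 1) * (1 + (n ∸ 1)) + 2 * (m ∸ 2)
    mQ-roots = trans (∑-twoPoints i j i≢j _ _ _ _ byCopy) (arith (n ∸ 1) (m ∸ 2))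
      where
      arith : ∀ N M → (N * 1 + 0 + M * 1) + N * (N * 1 + 0 + M * 0) + 0 + M * 1 ≡ N * (1 + N) + 2 * M
      arith = solve-∀

      fromCopy-i : ∑[ p < n ] ∑[ l′ < m ] closer i p l′
                   ≡ ((n ∸ 1) * 1 + 0 + (m ∸ 2) * 1) + (n ∸ 1) * ((n ∸ 1) * 1 + 0 + (m ∸ 2) * 0)
      fromCopy-i = trans (sum-cong-≗ {n} closer-fromCopy-i) (∑-onePoint o _ _ _ byVertex)
        where
        byVertex : ∀ p → (n ∸ 1) * 1 + 0 + (m ∸ 2) * (if isRoot p then 1 else 0)
                         ≡ (if eqV p o then (n ∸ 1) * 1 + 0 + (m ∸ 2) * 1 else (n ∸ 1) * 1 + 0 + (m ∸ 2) * 0)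
        byVertex p rewrite eqV-root o o-root p with isRoot p
        ... | true  = refl
        ... | false = refl

      fromCopy-other : ∀ l → eqV l i ≡ false → eqV l j ≡ false → ∑[ p < n ] ∑[ l′ < m ] closer l p l′ ≡ 1
      fromCopy-other l l≢i l≢j =
        trans (sum-cong-≗ {n} (λ p → closer-fromCopy-other l p l≢i l≢j)) (∑-onePoint₀ o _ 1 byVertex)
        where
        byVertex : ∀ p → (if isRoot p then 1 else 0) ≡ (if eqV p o then 1 else 0)
        byVertex p rewrite eqV-root o o-root p = refl

      byCopy : ∀ l → ∑[ p < n ] ∑[ l′ < m ] closer l p l′
                     ≡ (if eqV l i then ((n ∸ 1) * 1 + 0 + (m ∸ 2) * 1) + (n ∸ 1) * ((n ∸ 1) * 1 + 0 + (m ∸ 2) * 0)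
                        else if eqV l j then 0 else 1)
      byCopy l with eqV l i in e
      ... | true rewrite eqV⇒≡ {i = l} {i} e = fromCopy-i
      ... | false with eqV l j in e′
      ... | true rewrite eqV⇒≡ {i = l} {j} e′ = ∑-zero _ closer-fromCopy-j
      ... | false = fromCopy-other l e e′

2*Moe-Q : ∀ m′ n (o : Fin n) → isRoot o ≡ true →
          2 * Moe (Q (suc m′) n) ≡ suc m′ * (n ∸ 1) * m′ * (n * (n ∸ 1) + suc m′)
2*Moe-Q m′ n o o-root = *-cancelˡ-≡ _ _ 2 (begin
  2 * (2 * Moe (Q m n))                              ≡⟨ 4*Moe≡ ⟩
  ∑Q (onAdj V)                                       ≡⟨ ∑Q-onAdj V K V-inCopy V-roots ⟩
  2 * (m * ((n ∸ 1) * K))                            ≡⟨ arith m′ (n ∸ 1) (n * (n ∸ 1)) ⟩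
  2 * (m * (n ∸ 1) * m′ * (n * (n ∸ 1) + m))         ∎)
  where
  open ≡-Reasoning
  m : ℕ
  m = suc m′
  open Coordinates m n
  open Indices m n
  open EdgeSums m n o o-root
  open EdgeCounts m n o o-root

  K : ℕ
  K = m′ + m′ * (n * (n ∸ 1) + m′)

  arith : ∀ m′ N X → 2 * (suc m′ * (N * (m′ + m′ * (X + m′)))) ≡ 2 * (suc m′ * N * m′ * (X + suc m′))
  arith = solve-∀

  V : Fin m → Fin n → Fin m → Fin n → ℕ
  V i a j b = ∣ mQ i a j b - mQ j b i a ∣

  V-inCopy : ∀ i a b → eqV a b ≡ false → V i a i b ≡ (if isRoot a xor isRoot b then K else 0)
  V-inCopy i a b a≢b = trans (cong₂ ∣_-_∣ (InCopy.mQ-inCopy i a b a≢b) (InCopy.mQ-inCopy i b a (eqV-swap a b a≢b)))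
                             (∣-rootToLeaf ((n ∸ 2) * 1 + 0 + (n ∸ 2) * 1) K (isRoot a) (isRoot b))

  V-roots : ∀ i j a b → eqV i j ≡ false → isRoot a ≡ true → isRoot b ≡ true → V i a j b ≡ 0
  V-roots i j a b i≢j ra rb rewrite BetweenRoots.mQ-roots i j a b i≢j ra rb
                                  | BetweenRoots.mQ-roots j i b a (eqV-swap i j i≢j) rb ra =
    ∣n-n∣≡0 ((n ∸ 1) * (1 + (n ∸ 1)) + 2 * (m ∸ 2))

mainTheorem2 : (m n : ℕ) → m ≥ 1 → n ≥ 1 →
    (Mo (Q m n) ≡ m * n * (m ∸ 1) * (n ∸ 1))
    × (Moe (Q m n) ≡ (m * (n ∸ 1) * (m ∸ 1) * (n * n ∸ n + m)) / 2)
mainTheorem2 (suc m′) (suc n′) _ _ = Mo-Q m n zero refl , Moe≡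
  where
  m n : ℕ
  m = suc m′
  n = suc n′

  n*n∸n : n * n ∸ n ≡ n * n′
  n*n∸n = trans (cong (_∸ n) (*-suc n n′)) (m+n∸m≡n n (n * n′))

  Moe≡ : Moe (Q m n) ≡ (m * n′ * m′ * (n * n ∸ n + m)) / 2
  Moe≡ = begin
    Moe (Q m n)                              ≡⟨ m*n/n≡m (Moe (Q m n)) 2 ⟨
    (Moe (Q m n) * 2) / 2                    ≡⟨ cong (_/ 2) (*-comm (Moe (Q m n)) 2) ⟩
    (2 * Moe (Q m n)) / 2                    ≡⟨ cong (_/ 2) (2*Moe-Q m′ n zero refl) ⟩
    (m * n′ * m′ * (n * n′ + m)) / 2         ≡⟨ cong (λ t → (m * n′ * m′ * (t + m)) / 2) n*n∸n ⟨
    (m * n′ * m′ * (n * n ∸ n + m)) / 2      ∎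
    where open ≡-Reasoning
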